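{- For each non-negative integer $n$, \[ 2^n\sum_{k=0}^n (-1)^{k} \binom {n+k}{k} F_{2(n+1)+3k} = 1 - \sum_{k=0}^{n-1} (-2)^{k} \binom {2k+1}{k} L_{5k+8}, \] \[ 2^n \sum_{k=0}^n (-1)^{k} \binom {n+k}{k} L_{2(n+1)+3k} = 3 - 5 \sum_{k=0}^{n-1} (-2)^{k} \binom {2k+1}{k} F_{5k+8}. \]
   Context: $F_j$ and $L_j$ denote the Fibonacci and Lucas numbers: $F_0=0,F_1=1$, $L_0=2,L_1=1$, both satisfying $X_j=X_{j-1}+X_{j-2}$. -}

module Defs where

open import Data.Nat using (ℕ; zero; suc)
open import Data.Integer using (ℤ; +_; -_; _+_; _*_)

fib : ℕ → ℕ
fib zero = 0
fib (suc zero) = 1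
fib (suc (suc n)) = fib (suc n) Data.Nat.+ fib n

lucas : ℕ → ℕ
lucas zero = 2
lucas (suc zero) = 1
lucas (suc (suc n)) = lucas (suc n) Data.Nat.+ lucas n

sumBelow : ℕ → (ℕ → ℤ) → ℤ
sumBelow zero f = + 0
sumBelow (suc n) f = sumBelow n f + f n

sumTo : ℕ → (ℕ → ℤ) → ℤ
sumTo n f = sumBelow (suc n) f

_^ℤ_ : ℤ → ℕ → ℤ
x ^ℤ zero = + 1
x ^ℤ suc n = x * (x ^ℤ n)

-- The argument works for any sequence G with G (j + 2) = G (j + 1) + G j.
-- Put B (n , m) = Σ_{k ≤ n} C(n+k,k) (-1)^k G (m + 3k).  From G j + G (j + 3) = 2 G (j + 2)
-- one gets B (n , m) + B (n , m + 3) = 2 B (n , m + 2), while Pascal's rule writes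
-- B (n + 1 , m) + B (n + 1 , m + 3) as B (n , m) plus two boundary terms with coefficients
-- C(2n+1,n) and C(2n+2,n+1) = 2 C(2n+1,n).  For m = 2n + 2 this gives
--   2^(n+1) B (n + 1 , 2n + 4) = 2^n B (n , 2n + 2) - (-2)^n C(2n+1,n) (G (5n+5) + 2 G (5n+8)),
-- which telescopes down to B (0 , 2) = G 2.  Finally F_j + 2 F_(j+3) = L_(j+3) and
-- L_j + 2 L_(j+3) = 5 F_(j+3).
module Submission where

open import Defs
open import Data.Nat using (ℕ)
open import Data.Nat.Combinatorics using (_C_)
open import Data.Integer using (ℤ; +_; -_; _+_; _-_; _*_)
open import Data.Product using (_×_)
open import Relation.Binary.PropositionalEquality using (_≡_)

open import Data.Nat using (zero; suc)
import Data.Nat as ℕ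
import Data.Nat.Properties as ℕₚ
import Data.Integer.Properties as ℤₚ
open import Data.Nat.Combinatorics using (nCk+nC[k+1]≡[n+1]C[k+1]; nCk≡nC[n∸k])
open import Data.Product using (_,_)
open import Function using (_∘_)
open import Relation.Binary.PropositionalEquality using (refl; sym; trans; cong; cong₂; module ≡-Reasoning)
open import Data.Integer.Tactic.RingSolver using (solve-∀)
import Data.Nat.Tactic.RingSolver as ℕ-Solver

open ≡-Reasoning

sumBelow-cong : ∀ n {f g : ℕ → ℤ} → (∀ k → f k ≡ g k) → sumBelow n f ≡ sumBelow n g
sumBelow-cong zero    f≗g = refl
sumBelow-cong (suc n) f≗g = cong₂ _+_ (sumBelow-cong n f≗g) (f≗g n)

sumBelow-distribˡ-* : ∀ n c (f : ℕ → ℤ) → sumBelow n (λ k → c * f k) ≡ c * sumBelow n f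
sumBelow-distribˡ-* zero    c f = sym (ℤₚ.*-zeroʳ c)
sumBelow-distribˡ-* (suc n) c f =
  trans (cong (_+ c * f n) (sumBelow-distribˡ-* n c f)) (sym (ℤₚ.*-distribˡ-+ c (sumBelow n f) (f n)))

sumBelow-distrib-- : ∀ n (f g : ℕ → ℤ) → sumBelow n (λ k → f k - g k) ≡ sumBelow n f - sumBelow n g
sumBelow-distrib-- zero    f g = refl
sumBelow-distrib-- (suc n) f g =
  trans (cong (_+ (f n - g n)) (sumBelow-distrib-- n f g)) (interchange (sumBelow n f) (sumBelow n g) (f n) (g n))
  where
  interchange : ∀ a b c d → a - b + (c - d) ≡ a + c - (b + d)
  interchange = solve-∀

^ℤ-distribʳ-* : ∀ x y n → (x * y) ^ℤ n ≡ x ^ℤ n * y ^ℤ n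
^ℤ-distribʳ-* x y zero    = refl
^ℤ-distribʳ-* x y (suc n) = trans (cong ((x * y) *_) (^ℤ-distribʳ-* x y n)) (reassoc x y (x ^ℤ n) (y ^ℤ n))
  where
  reassoc : ∀ x y a b → x * y * (a * b) ≡ x * a * (y * b)
  reassoc = solve-∀

[1+n+1+k]C[1+k] : ∀ n k → (suc n ℕ.+ suc k) C suc k ≡ (n ℕ.+ suc k) C suc k ℕ.+ (suc n ℕ.+ k) C k
[1+n+1+k]C[1+k] n k = begin
  (suc n ℕ.+ suc k) C suc k                     ≡⟨ sym (nCk+nC[k+1]≡[n+1]C[k+1] (n ℕ.+ suc k) k) ⟩
  (n ℕ.+ suc k) C k ℕ.+ (n ℕ.+ suc k) C suc k   ≡⟨ ℕₚ.+-comm ((n ℕ.+ suc k) C k) _ ⟩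
  (n ℕ.+ suc k) C suc k ℕ.+ (n ℕ.+ suc k) C k   ≡⟨ cong (λ m → (n ℕ.+ suc k) C suc k ℕ.+ m C k) (ℕₚ.+-suc n k) ⟩
  (n ℕ.+ suc k) C suc k ℕ.+ (suc n ℕ.+ k) C k   ∎

n+[1+n]≡2n+1 : ∀ n → n ℕ.+ suc n ≡ 2 ℕ.* n ℕ.+ 1
n+[1+n]≡2n+1 = ℕ-Solver.solve-∀

[2n+1]C[n+1]≡[2n+1]Cn : ∀ n → (n ℕ.+ suc n) C suc n ≡ (2 ℕ.* n ℕ.+ 1) C n
[2n+1]C[n+1]≡[2n+1]Cn n = begin
  (n ℕ.+ suc n) C suc n                   ≡⟨ nCk≡nC[n∸k] (ℕₚ.m≤n+m (suc n) n) ⟩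
  (n ℕ.+ suc n) C (n ℕ.+ suc n ℕ.∸ suc n) ≡⟨ cong ((n ℕ.+ suc n) C_) (ℕₚ.m+n∸n≡m n (suc n)) ⟩
  (n ℕ.+ suc n) C n                       ≡⟨ cong (_C n) (n+[1+n]≡2n+1 n) ⟩
  (2 ℕ.* n ℕ.+ 1) C n                     ∎

[2n+2]C[n+1]≡2*[2n+1]Cn : ∀ n → (suc n ℕ.+ suc n) C suc n ≡ 2 ℕ.* ((2 ℕ.* n ℕ.+ 1) C n)
[2n+2]C[n+1]≡2*[2n+1]Cn n = begin
  (suc n ℕ.+ suc n) C suc n                       ≡⟨ [1+n+1+k]C[1+k] n n ⟩
  (n ℕ.+ suc n) C suc n ℕ.+ (suc n ℕ.+ n) C n     ≡⟨ cong₂ ℕ._+_ ([2n+1]C[n+1]≡[2n+1]Cn n) (cong (_C n) (ℕₚ.+-comm (suc n) n)) ⟩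
  c ℕ.+ (n ℕ.+ suc n) C n                         ≡⟨ cong (λ m → c ℕ.+ m C n) (n+[1+n]≡2n+1 n) ⟩
  c ℕ.+ c                                         ≡⟨ cong (c ℕ.+_) (sym (ℕₚ.+-identityʳ c)) ⟩
  2 ℕ.* c                                         ∎
  where
  c : ℕ
  c = (2 ℕ.* n ℕ.+ 1) C n

binomialSum : ℕ → (ℕ → ℤ) → ℤ
binomialSum n a = sumTo n (λ k → + ((n ℕ.+ k) C k) * a k)

binomialSum-difference : ∀ n c {a b d : ℕ → ℤ} → (∀ k → a k - b k ≡ c * d k) →
                         binomialSum n a - binomialSum n b ≡ c * binomialSum n d
binomialSum-difference n c {a} {b} {d} a-b≗cd = begin
  binomialSum n a - binomialSum n b          ≡⟨ sym (sumBelow-distrib-- (suc n) (λ k → w k * a k) (λ k → w k * b k)) ⟩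
  sumTo n (λ k → w k * a k - w k * b k)      ≡⟨ sumBelow-cong (suc n) (λ k → trans (factor (w k) (a k) (b k)) (cong (w k *_) (a-b≗cd k))) ⟩
  sumTo n (λ k → w k * (c * d k))            ≡⟨ sumBelow-cong (suc n) (λ k → swap (w k) c (d k)) ⟩
  sumTo n (λ k → c * (w k * d k))            ≡⟨ sumBelow-distribˡ-* (suc n) c (λ k → w k * d k) ⟩
  c * binomialSum n d                        ∎
  where
  w : ℕ → ℤ
  w k = + ((n ℕ.+ k) C k)
  factor : ∀ w x y → w * x - w * y ≡ w * (x - y)
  factor = solve-∀
  swap : ∀ w c d → w * (c * d) ≡ c * (w * d)
  swap = solve-∀

sumBelow-pascal : ∀ n t (a : ℕ → ℤ) →
  sumBelow (suc t) (λ k → + ((suc n ℕ.+ k) C k) * a k)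
    ≡ sumBelow (suc t) (λ k → + ((n ℕ.+ k) C k) * a k) + sumBelow t (λ k → + ((suc n ℕ.+ k) C k) * a (suc k))
sumBelow-pascal n zero    a = base (a 0)
  where
  base : ∀ x → + 0 + + 1 * x ≡ + 0 + + 1 * x + + 0
  base = solve-∀
sumBelow-pascal n (suc t) a = begin
  S + + ((suc n ℕ.+ suc t) C suc t) * a (suc t)   ≡⟨ cong₂ (λ s c → s + + c * a (suc t)) (sumBelow-pascal n t a) ([1+n+1+k]C[1+k] n t) ⟩
  (S′ + Q) + + (x ℕ.+ y) * a (suc t)              ≡⟨ cong (λ c → (S′ + Q) + c * a (suc t)) (ℤₚ.pos-+ x y) ⟩
  (S′ + Q) + (+ x + + y) * a (suc t)              ≡⟨ regroup S′ Q (+ x) (+ y) (a (suc t)) ⟩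
  (S′ + + x * a (suc t)) + (Q + + y * a (suc t))  ∎
  where
  S : ℤ
  S = sumBelow (suc t) (λ k → + ((suc n ℕ.+ k) C k) * a k)
  S′ : ℤ
  S′ = sumBelow (suc t) (λ k → + ((n ℕ.+ k) C k) * a k)
  Q : ℤ
  Q = sumBelow t (λ k → + ((suc n ℕ.+ k) C k) * a (suc k))
  x : ℕ
  x = (n ℕ.+ suc t) C suc t
  y : ℕ
  y = (suc n ℕ.+ t) C t
  regroup : ∀ s q x y z → (s + q) + (x + y) * z ≡ (s + x * z) + (q + y * z)
  regroup = solve-∀

binomialSum-suc-difference : ∀ n (a : ℕ → ℤ) →
  binomialSum (suc n) a - binomialSum (suc n) (a ∘ suc)
    ≡ binomialSum n a + (+ ((n ℕ.+ suc n) C suc n) * a (suc n) - + ((suc n ℕ.+ suc n) C suc n) * a (suc (suc n)))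
binomialSum-suc-difference n a =
  trans (cong (_- binomialSum (suc n) (a ∘ suc)) (sumBelow-pascal n (suc n) a))
        (cancel (binomialSum n a) _ _ _)
  where
  cancel : ∀ b x q y → (b + x) + q - (q + y) ≡ b + (x - y)
  cancel = solve-∀

module Gibonacci (G : ℕ → ℤ) (G-rec : ∀ j → G (2 ℕ.+ j) ≡ G (1 ℕ.+ j) + G j) where

  G[j]+G[3+j]≡2G[2+j] : ∀ j → G j + G (3 ℕ.+ j) ≡ + 2 * G (2 ℕ.+ j)
  G[j]+G[3+j]≡2G[2+j] j = begin
    G j + G (3 ℕ.+ j)                      ≡⟨ cong (_+_ (G j)) (G-rec (suc j)) ⟩
    G j + (G (2 ℕ.+ j) + G (1 ℕ.+ j))      ≡⟨ rotate (G j) (G (2 ℕ.+ j)) (G (1 ℕ.+ j)) ⟩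
    G (2 ℕ.+ j) + (G (1 ℕ.+ j) + G j)      ≡⟨ cong (_+_ (G (2 ℕ.+ j))) (sym (G-rec j)) ⟩
    G (2 ℕ.+ j) + G (2 ℕ.+ j)              ≡⟨ double (G (2 ℕ.+ j)) ⟩
    + 2 * G (2 ℕ.+ j)                      ∎
    where
    rotate : ∀ x y z → x + (y + z) ≡ y + (z + x)
    rotate = solve-∀
    double : ∀ x → x + x ≡ + 2 * x
    double = solve-∀

  signedTrisection : ℕ → ℕ → ℤ
  signedTrisection m k = (- + 1) ^ℤ k * G (m ℕ.+ 3 ℕ.* k)

  signedTrisection-step : ∀ m k → signedTrisection m k - signedTrisection m (suc k) ≡ + 2 * signedTrisection (2 ℕ.+ m) k
  signedTrisection-step m k = begin
    σ * G j - (- + 1 * σ) * G (m ℕ.+ 3 ℕ.* suc k)   ≡⟨ cong (λ i → σ * G j - (- + 1 * σ) * G i) (m+3[1+k]≡3+[m+3k] m k) ⟩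
    σ * G j - (- + 1 * σ) * G (3 ℕ.+ j)             ≡⟨ factor σ (G j) (G (3 ℕ.+ j)) ⟩
    σ * (G j + G (3 ℕ.+ j))                         ≡⟨ cong (σ *_) (G[j]+G[3+j]≡2G[2+j] j) ⟩
    σ * (+ 2 * G (2 ℕ.+ j))                         ≡⟨ swap σ (G (2 ℕ.+ j)) ⟩
    + 2 * (σ * G (2 ℕ.+ j))                         ∎
    where
    σ : ℤ
    σ = (- + 1) ^ℤ k
    j : ℕ
    j = m ℕ.+ 3 ℕ.* k
    m+3[1+k]≡3+[m+3k] : ∀ m k → m ℕ.+ 3 ℕ.* suc k ≡ 3 ℕ.+ (m ℕ.+ 3 ℕ.* k)
    m+3[1+k]≡3+[m+3k] = ℕ-Solver.solve-∀
    factor : ∀ σ x y → σ * x - (- + 1 * σ) * y ≡ σ * (x + y)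
    factor = solve-∀
    swap : ∀ σ x → σ * (+ 2 * x) ≡ + 2 * (σ * x)
    swap = solve-∀

  binomialSum-signedTrisection : ∀ n m →
    binomialSum n (signedTrisection m) - binomialSum n (signedTrisection m ∘ suc) ≡ + 2 * binomialSum n (signedTrisection (2 ℕ.+ m))
  binomialSum-signedTrisection n m = binomialSum-difference n (+ 2) (signedTrisection-step m)

  boundaryTerms : ∀ n → let m = 2 ℕ.* (n ℕ.+ 1) in
    + ((n ℕ.+ suc n) C suc n) * signedTrisection m (suc n) - + ((suc n ℕ.+ suc n) C suc n) * signedTrisection m (suc (suc n))
      ≡ - ((- + 1) ^ℤ n * + ((2 ℕ.* n ℕ.+ 1) C n) * (G (5 ℕ.* n ℕ.+ 5) + + 2 * G (5 ℕ.* n ℕ.+ 8)))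
  boundaryTerms n = begin
    + ((n ℕ.+ suc n) C suc n) * (- + 1 * σ * G (m ℕ.+ 3 ℕ.* suc n))
      - + ((suc n ℕ.+ suc n) C suc n) * (- + 1 * (- + 1 * σ) * G (m ℕ.+ 3 ℕ.* suc (suc n)))
        ≡⟨ cong₂ (λ c i → + c * (- + 1 * σ * G i) - + ((suc n ℕ.+ suc n) C suc n) * (- + 1 * (- + 1 * σ) * G (m ℕ.+ 3 ℕ.* suc (suc n))))
                 ([2n+1]C[n+1]≡[2n+1]Cn n) (m+3[1+n]≡5n+5 n) ⟩
    + c * (- + 1 * σ * G (5 ℕ.* n ℕ.+ 5)) - + ((suc n ℕ.+ suc n) C suc n) * (- + 1 * (- + 1 * σ) * G (m ℕ.+ 3 ℕ.* suc (suc n)))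
        ≡⟨ cong₂ (λ d i → + c * (- + 1 * σ * G (5 ℕ.* n ℕ.+ 5)) - d * (- + 1 * (- + 1 * σ) * G i))
                 (trans (cong +_ ([2n+2]C[n+1]≡2*[2n+1]Cn n)) (ℤₚ.pos-* 2 c)) (m+3[2+n]≡5n+8 n) ⟩
    + c * (- + 1 * σ * G (5 ℕ.* n ℕ.+ 5)) - + 2 * + c * (- + 1 * (- + 1 * σ) * G (5 ℕ.* n ℕ.+ 8))
        ≡⟨ collect (+ c) σ (G (5 ℕ.* n ℕ.+ 5)) (G (5 ℕ.* n ℕ.+ 8)) ⟩
    - (σ * + c * (G (5 ℕ.* n ℕ.+ 5) + + 2 * G (5 ℕ.* n ℕ.+ 8))) ∎
    where
    m : ℕ
    m = 2 ℕ.* (n ℕ.+ 1)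
    σ : ℤ
    σ = (- + 1) ^ℤ n
    c : ℕ
    c = (2 ℕ.* n ℕ.+ 1) C n
    m+3[1+n]≡5n+5 : ∀ n → 2 ℕ.* (n ℕ.+ 1) ℕ.+ 3 ℕ.* suc n ≡ 5 ℕ.* n ℕ.+ 5
    m+3[1+n]≡5n+5 = ℕ-Solver.solve-∀
    m+3[2+n]≡5n+8 : ∀ n → 2 ℕ.* (n ℕ.+ 1) ℕ.+ 3 ℕ.* suc (suc n) ≡ 5 ℕ.* n ℕ.+ 8
    m+3[2+n]≡5n+8 = ℕ-Solver.solve-∀
    collect : ∀ c σ x y → c * (- + 1 * σ * x) - + 2 * c * (- + 1 * (- + 1 * σ) * y) ≡ - (σ * c * (x + + 2 * y))
    collect = solve-∀

  correction : ℕ → ℤ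
  correction k = (- + 2) ^ℤ k * + ((2 ℕ.* k ℕ.+ 1) C k) * (G (5 ℕ.* k ℕ.+ 5) + + 2 * G (5 ℕ.* k ℕ.+ 8))

  scaledBinomialSum : ∀ n → (+ 2) ^ℤ n * binomialSum n (signedTrisection (2 ℕ.* (n ℕ.+ 1))) ≡ G 2 - sumBelow n correction
  scaledBinomialSum zero = base (G 2)
    where
    base : ∀ x → + 1 * (+ 0 + + 1 * (+ 1 * x)) ≡ x - + 0
    base = solve-∀
  scaledBinomialSum (suc n) = begin
    (+ 2 * p) * binomialSum (suc n) (signedTrisection (2 ℕ.* (suc n ℕ.+ 1)))
      ≡⟨ cong (λ i → (+ 2 * p) * binomialSum (suc n) (signedTrisection i)) (2[n+2]≡2+2[n+1] n) ⟩
    (+ 2 * p) * binomialSum (suc n) (signedTrisection (2 ℕ.+ m))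
      ≡⟨ shift p _ ⟩
    p * (+ 2 * binomialSum (suc n) (signedTrisection (2 ℕ.+ m)))
      ≡⟨ cong (p *_) (sym (binomialSum-signedTrisection (suc n) m)) ⟩
    p * (binomialSum (suc n) (signedTrisection m) - binomialSum (suc n) (signedTrisection m ∘ suc))
      ≡⟨ cong (p *_) (binomialSum-suc-difference n (signedTrisection m)) ⟩
    p * (binomialSum n (signedTrisection m) + _)
      ≡⟨ cong (λ b → p * (binomialSum n (signedTrisection m) + b)) (boundaryTerms n) ⟩
    p * (binomialSum n (signedTrisection m) + - (σ * + c * h))
      ≡⟨ distribute p _ σ (+ c) h ⟩
    p * binomialSum n (signedTrisection m) - σ * p * + c * h
      ≡⟨ cong₂ (λ s τ → s - τ * + c * h) (scaledBinomialSum n) (sym (^ℤ-distribʳ-* (- + 1) (+ 2) n)) ⟩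
    G 2 - sumBelow n correction - correction n
      ≡⟨ subtract-twice (G 2) (sumBelow n correction) (correction n) ⟩
    G 2 - sumBelow (suc n) correction
      ∎
    where
    p : ℤ
    p = (+ 2) ^ℤ n
    m : ℕ
    m = 2 ℕ.* (n ℕ.+ 1)
    σ : ℤ
    σ = (- + 1) ^ℤ n
    c : ℕ
    c = (2 ℕ.* n ℕ.+ 1) C n
    h : ℤ
    h = G (5 ℕ.* n ℕ.+ 5) + + 2 * G (5 ℕ.* n ℕ.+ 8)
    2[n+2]≡2+2[n+1] : ∀ n → 2 ℕ.* (suc n ℕ.+ 1) ≡ 2 ℕ.+ 2 ℕ.* (n ℕ.+ 1)
    2[n+2]≡2+2[n+1] = ℕ-Solver.solve-∀
    shift : ∀ p x → (+ 2 * p) * x ≡ p * (+ 2 * x)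
    shift = solve-∀
    distribute : ∀ p b σ c h → p * (b + - (σ * c * h)) ≡ p * b - σ * p * c * h
    distribute = solve-∀
    subtract-twice : ∀ g s x → g - s - x ≡ g - (s + x)
    subtract-twice = solve-∀

  alternatingBinomialSum : ∀ n →
    (+ 2) ^ℤ n * sumTo n (λ k → (- + 1) ^ℤ k * + ((n ℕ.+ k) C k) * G (2 ℕ.* (n ℕ.+ 1) ℕ.+ 3 ℕ.* k))
      ≡ G 2 - sumBelow n correction
  alternatingBinomialSum n =
    trans (cong ((+ 2) ^ℤ n *_) (sumBelow-cong (suc n) (λ k → swap ((- + 1) ^ℤ k) _ _))) (scaledBinomialSum n)
    where
    swap : ∀ σ c x → σ * c * x ≡ c * (σ * x)
    swap = solve-∀

[a+b]+2[c+d]≡[a+2c]+[b+2d] : ∀ a b c d → (a ℕ.+ b) ℕ.+ 2 ℕ.* (c ℕ.+ d) ≡ (a ℕ.+ 2 ℕ.* c) ℕ.+ (b ℕ.+ 2 ℕ.* d)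
[a+b]+2[c+d]≡[a+2c]+[b+2d] = ℕ-Solver.solve-∀

fib[j]+2fib[j+3]≡lucas[j+3] : ∀ j → fib j ℕ.+ 2 ℕ.* fib (j ℕ.+ 3) ≡ lucas (j ℕ.+ 3)
fib[j]+2fib[j+3]≡lucas[j+3] zero          = refl
fib[j]+2fib[j+3]≡lucas[j+3] (suc zero)    = refl
fib[j]+2fib[j+3]≡lucas[j+3] (suc (suc j)) =
  trans ([a+b]+2[c+d]≡[a+2c]+[b+2d] (fib (suc j)) (fib j) (fib (suc (j ℕ.+ 3))) (fib (j ℕ.+ 3)))
        (cong₂ ℕ._+_ (fib[j]+2fib[j+3]≡lucas[j+3] (suc j)) (fib[j]+2fib[j+3]≡lucas[j+3] j))

lucas[j]+2lucas[j+3]≡5fib[j+3] : ∀ j → lucas j ℕ.+ 2 ℕ.* lucas (j ℕ.+ 3) ≡ 5 ℕ.* fib (j ℕ.+ 3)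
lucas[j]+2lucas[j+3]≡5fib[j+3] zero          = refl
lucas[j]+2lucas[j+3]≡5fib[j+3] (suc zero)    = refl
lucas[j]+2lucas[j+3]≡5fib[j+3] (suc (suc j)) =
  trans ([a+b]+2[c+d]≡[a+2c]+[b+2d] (lucas (suc j)) (lucas j) (lucas (suc (j ℕ.+ 3))) (lucas (j ℕ.+ 3)))
        (trans (cong₂ ℕ._+_ (lucas[j]+2lucas[j+3]≡5fib[j+3] (suc j)) (lucas[j]+2lucas[j+3]≡5fib[j+3] j))
               (sym (ℕₚ.*-distribˡ-+ 5 (fib (suc (j ℕ.+ 3))) (fib (j ℕ.+ 3)))))

pos-[x+2y] : ∀ x y → + (x ℕ.+ 2 ℕ.* y) ≡ + x + + 2 * + y
pos-[x+2y] x y = trans (ℤₚ.pos-+ x (2 ℕ.* y)) (cong (_+_ (+ x)) (ℤₚ.pos-* 2 y))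

fib[5k+5]+2fib[5k+8]≡lucas[5k+8] : ∀ k → + fib (5 ℕ.* k ℕ.+ 5) + + 2 * + fib (5 ℕ.* k ℕ.+ 8) ≡ + lucas (5 ℕ.* k ℕ.+ 8)
fib[5k+5]+2fib[5k+8]≡lucas[5k+8] k rewrite sym (ℕₚ.+-assoc (5 ℕ.* k) 5 3) =
  trans (sym (pos-[x+2y] (fib j) (fib (j ℕ.+ 3)))) (cong +_ (fib[j]+2fib[j+3]≡lucas[j+3] j))
  where
  j : ℕ
  j = 5 ℕ.* k ℕ.+ 5

lucas[5k+5]+2lucas[5k+8]≡5fib[5k+8] : ∀ k → + lucas (5 ℕ.* k ℕ.+ 5) + + 2 * + lucas (5 ℕ.* k ℕ.+ 8) ≡ + 5 * + fib (5 ℕ.* k ℕ.+ 8)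
lucas[5k+5]+2lucas[5k+8]≡5fib[5k+8] k rewrite sym (ℕₚ.+-assoc (5 ℕ.* k) 5 3) =
  trans (sym (pos-[x+2y] (lucas j) (lucas (j ℕ.+ 3))))
        (trans (cong +_ (lucas[j]+2lucas[j+3]≡5fib[j+3] j)) (ℤₚ.pos-* 5 (fib (j ℕ.+ 3))))
  where
  j : ℕ
  j = 5 ℕ.* k ℕ.+ 5

theorem19 : (n : ℕ) →
    ((+ 2) ^ℤ n) * sumTo n (λ k → ((- + 1) ^ℤ k) * (+ ((n Data.Nat.+ k) C k)) * (+ fib (2 Data.Nat.* (n Data.Nat.+ 1) Data.Nat.+ 3 Data.Nat.* k)))
      ≡ + 1 - sumBelow n (λ k → ((- + 2) ^ℤ k) * (+ ((2 Data.Nat.* k Data.Nat.+ 1) C k)) * (+ lucas (5 Data.Nat.* k Data.Nat.+ 8)))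
    ×
    ((+ 2) ^ℤ n) * sumTo n (λ k → ((- + 1) ^ℤ k) * (+ ((n Data.Nat.+ k) C k)) * (+ lucas (2 Data.Nat.* (n Data.Nat.+ 1) Data.Nat.+ 3 Data.Nat.* k)))
      ≡ + 3 - (+ 5) * sumBelow n (λ k → ((- + 2) ^ℤ k) * (+ ((2 Data.Nat.* k Data.Nat.+ 1) C k)) * (+ fib (5 Data.Nat.* k Data.Nat.+ 8)))
theorem19 n =
  trans (Gibonacci.alternatingBinomialSum (+_ ∘ fib) (λ j → ℤₚ.pos-+ (fib (suc j)) (fib j)) n)
        (cong (_-_ (+ 1)) (sumBelow-cong n (λ k → cong (weight k *_) (fib[5k+5]+2fib[5k+8]≡lucas[5k+8] k))))
  ,
  trans (Gibonacci.alternatingBinomialSum (+_ ∘ lucas) (λ j → ℤₚ.pos-+ (lucas (suc j)) (lucas j)) n)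
        (cong (_-_ (+ 3)) (trans (sumBelow-cong n (λ k → trans (cong (weight k *_) (lucas[5k+5]+2lucas[5k+8]≡5fib[5k+8] k))
                                                              (swap (weight k) (+ 5) (+ fib (5 ℕ.* k ℕ.+ 8)))))
                                 (sumBelow-distribˡ-* n (+ 5) (λ k → weight k * + fib (5 ℕ.* k ℕ.+ 8)))))
  where
  weight : ℕ → ℤ
  weight k = (- + 2) ^ℤ k * + ((2 ℕ.* k ℕ.+ 1) C k)
  swap : ∀ w c x → w * (c * x) ≡ c * (w * x)
  swap = solve-∀
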